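{- For each connected graph $\mathcal{G}$ with vertices $v_1,\dots,v_n$ there exists a formal series $\tau(x)=\sum_{\gamma\in\mathbb{Z}^n}c_\gamma x^\gamma$ with $c_\gamma\in\mathbb{Z}$ such that \[\mathcal{H}_\alpha(x)=x^\alpha\,\tau(x)\quad\text{for all }\alpha\in\mathbb{Z}^n,\] where $x^\alpha\tau(x)=\sum_\gamma c_\gamma x^{\alpha+\gamma}$.
   Context: $\mathcal{G}=(V,E)$ is a connected graph with vertex set $V=\{v_1,\dots,v_n\}$, no loops and at most one edge between any two vertices. $\epsilon_i\in\mathbb{Z}^n$ is the $i$th standard basis vector, $d_i$ the degree of $v_i$, $\Delta_i=\big(\sum_{j:\{v_j,v_i\}\in E}\epsilon_j\big)-d_i\epsilon_i$, $T_i(\alpha)=\alpha+\Delta_i$, and $T^a=T_1^{a_1}\cdots T_n^{a_n}$ for $a\in\mathbb{Z}^n$. Toppling dominance: $\beta\le\alpha$ iff $\beta=T^\lambda(\alpha)$ for some $\lambda\in\mathbb{N}^n$ with $\lambda_1\ge\cdots\ge\lambda_n$. For $\alpha\in\mathbb{Z}^n$, $x^\alpha=x_1^{\alpha_1}\cdots x_n^{\alpha_n}$, and $\mathcal{H}_\alpha(x)=\sum_{\beta\le\alpha}x^\beta$, a formal series (arbitrary formal $\mathbb{Z}$-linear combination of Laurent monomials in $x_1,\dots,x_n$). -}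

module Defs where

open import Data.Nat as ℕ using (ℕ)
open import Data.Integer using (ℤ; +_; _+_; _-_; _*_; 0ℤ)
open import Data.Fin using (Fin; zero; suc; _≟_) renaming (_≤_ to _≤ᶠ_)
open import Data.Bool using (Bool; true; false; if_then_else_)
open import Data.Product using (Σ; _×_; ∃)
open import Data.Sum using (_⊎_)
open import Relation.Nullary using (¬_; does)
open import Relation.Binary.PropositionalEquality using (_≡_)
open import Relation.Binary.Construct.Closure.ReflexiveTransitive using (Star)

sumFin : ∀ {n} → (Fin n → ℤ) → ℤ
sumFin {ℕ.zero}  f = 0ℤ
sumFin {ℕ.suc n} f = f zero + sumFin (λ i → f (suc i))

ℤVec : ℕ → Set
ℤVec n = Fin n → ℤ

_⊖_ : ∀ {n} → ℤVec n → ℤVec n → ℤVec n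
(a ⊖ b) k = a k - b k

-- A simple graph on vertex set {v₁,…,vₙ} = Fin n: symmetric, loopless
-- adjacency (at most one edge between two vertices).
record Graph (n : ℕ) : Set where
  field
    adj       : Fin n → Fin n → Bool
    adj-sym   : ∀ i j → adj i j ≡ adj j i
    adj-irrefl : ∀ i → adj i i ≡ false

open Graph public

Adjacent : ∀ {n} → Graph n → Fin n → Fin n → Set
Adjacent G i j = adj G i j ≡ true

Connected : ∀ {n} → Graph n → Set
Connected {n} G = ∀ (i j : Fin n) → Star (Adjacent G) i j

ind : Bool → ℤ
ind b = if b then + 1 else 0ℤ

degree : ∀ {n} → Graph n → Fin n → ℤ
degree G i = sumFin (λ j → ind (adj G i j))

Δ : ∀ {n} → Graph n → Fin n → ℤVec n
Δ G i k = ind (adj G k i) - ind (does (k ≟ i)) * degree G i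

-- T^a(α) = α + Σᵢ aᵢ Δᵢ   (the Tᵢ are commuting translations)
T^ : ∀ {n} → Graph n → (Fin n → ℤ) → ℤVec n → ℤVec n
T^ G a α k = α k + sumFin (λ i → a i * Δ G i k)

WeaklyDecreasing : ∀ {n} → (Fin n → ℕ) → Set
WeaklyDecreasing {n} λ′ = ∀ (i j : Fin n) → i ≤ᶠ j → λ′ j ℕ.≤ λ′ i

Dominated : ∀ {n} → Graph n → ℤVec n → ℤVec n → Set
Dominated {n} G β α =
  Σ (Fin n → ℕ) λ l → WeaklyDecreasing l × (∀ k → β k ≡ T^ G (λ i → + l i) α k)

-- The coefficient of x^β in 𝓗_α(x) = Σ_{β ≤ α} x^β is z.
HCoeff : ∀ {n} → Graph n → ℤVec n → ℤVec n → ℤ → Set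
HCoeff G α β z = (Dominated G β α × z ≡ + 1) ⊎ (¬ Dominated G β α × z ≡ 0ℤ)

-- T^λ α = α + Σᵢ λᵢΔᵢ, so whether β ≤ α depends only on γ = β − α: it asks for
-- γ = Σᵢ λᵢΔᵢ with λ ∈ ℕⁿ weakly decreasing, and c_γ is the indicator of that set.
-- The content is that membership is decidable. Constant vectors are in the kernel, and
-- modulo them a weakly decreasing λ is an ℕ-combination of the prefix indicators 1_{≤m}
-- (m < n − 1), so the set is the monoid generated by g_m = Σ_{i≤m} Δᵢ. For the rank
-- vector w = (0, 1, …, n − 1), 2⟨w, g_m⟩ = Σ_{k~i} (w_k − w_i)(1_{i≤m} − 1_{k≤m}) has
-- only nonnegative terms, and connectivity supplies an edge leaving {v ≤ m}, so
-- ⟨w, g_m⟩ ≥ 1. Hence ⟨w, ·⟩ bounds the number of generators in any decomposition of γ,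
-- and a finite search decides membership.

module Submission where

open import Defs
open import Data.Nat as ℕ using (ℕ; zero; suc; z≤n; s≤s; _∸_)
import Data.Nat.Properties as ℕₚ
open import Data.Integer using (ℤ; +_; -[1+_]; _+_; _-_; _*_; -_; 0ℤ; _≤_; _<_; +≤+; +<+; -<+; ∣_∣)
import Data.Integer.Properties as ℤₚ
open import Data.Integer.Tactic.RingSolver using (solve-∀)
open import Data.Fin using (Fin; zero; suc; _≟_; toℕ; inject₁; fromℕ) renaming (_≤_ to _≤ᶠ_)
open import Data.Bool using (true; false)
open import Relation.Nullary using (Dec; does; yes; no; ¬_; contradiction)
import Relation.Nullary.Decidable as Dec
open import Data.Product using (Σ; ∃; ∃₂; _,_; _×_)
open import Function.Bundles using (_⇔_; mk⇔; Equivalence)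
open import Data.Sum using (_⊎_; inj₁; inj₂)
open import Relation.Unary using (Pred; Decidable)
open import Relation.Binary using (Rel)
open import Relation.Binary.Construct.Closure.ReflexiveTransitive using (Star; ε; _◅_)
open import Data.Fin.Properties using (any?; all?; toℕ-inject₁; toℕ-fromℕ; toℕ<n) renaming (_≤?_ to _≤ᶠ?_)
open import Relation.Binary.PropositionalEquality
open import Algebra.Properties.Semiring.Sum ℤₚ.+-*-semiring
  using (sum; sum-cong-≗; sum-replicate-zero; ∑-distrib-+; ∑-comm; *-distribˡ-sum)

sumFin≡sum : ∀ {n} (f : Fin n → ℤ) → sumFin f ≡ sum f
sumFin≡sum {zero}  f = refl
sumFin≡sum {suc n} f = cong (_+_ (f zero)) (sumFin≡sum (λ i → f (suc i)))

∑-distrib-− : ∀ {n} (f g : Fin n → ℤ) → sum (λ i → f i - g i) ≡ sum f - sum g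
∑-distrib-− {zero}  f g = refl
∑-distrib-− {suc n} f g =
  trans (cong (_+_ (f zero - g zero)) (∑-distrib-− (λ i → f (suc i)) (λ i → g (suc i))))
        (shuffle (f zero) (g zero) _ _)
  where
  shuffle : ∀ a b c d → a - b + (c - d) ≡ a + c - (b + d)
  shuffle = solve-∀

∑-select : ∀ {n} (k : Fin n) (f : Fin n → ℤ) → sum (λ i → ind (does (k ≟ i)) * f i) ≡ f k
∑-select {suc n} zero f =
  trans (cong₂ _+_ (ℤₚ.*-identityˡ (f zero)) (sum-replicate-zero n)) (ℤₚ.+-identityʳ (f zero))
∑-select (suc k) f = trans (ℤₚ.+-identityˡ _)
  (trans (sum-cong-≗ peel) (∑-select k (λ i → f (suc i))))
  where
  peel : ∀ i → ind (does (suc k ≟ suc i)) * f (suc i) ≡ ind (does (k ≟ i)) * f (suc i)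
  peel i with k ≟ i
  ... | yes _ = refl
  ... | no  _ = refl

∑-nonneg : ∀ {n} (f : Fin n → ℤ) → (∀ i → 0ℤ ≤ f i) → 0ℤ ≤ sum f
∑-nonneg {zero}  f f≥0 = ℤₚ.≤-refl
∑-nonneg {suc n} f f≥0 =
  ℤₚ.+-mono-≤ (f≥0 zero) (∑-nonneg (λ i → f (suc i)) (λ i → f≥0 (suc i)))

term≤∑ : ∀ {n} (f : Fin n → ℤ) → (∀ i → 0ℤ ≤ f i) → ∀ j → f j ≤ sum f
term≤∑ f f≥0 zero = ℤₚ.≤-trans (ℤₚ.≤-reflexive (sym (ℤₚ.+-identityʳ (f zero))))
  (ℤₚ.+-monoʳ-≤ (f zero) (∑-nonneg (λ i → f (suc i)) (λ i → f≥0 (suc i))))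
term≤∑ f f≥0 (suc j) = ℤₚ.≤-trans (term≤∑ (λ i → f (suc i)) (λ i → f≥0 (suc i)) j)
  (ℤₚ.≤-trans (ℤₚ.≤-reflexive (sym (ℤₚ.+-identityˡ _))) (ℤₚ.+-monoˡ-≤ _ (f≥0 zero)))

1≤i+i⇒1≤i : ∀ i → + 1 ≤ i + i → + 1 ≤ i
1≤i+i⇒1≤i (+ suc k) _ = +≤+ (s≤s z≤n)
1≤i+i⇒1≤i (+ zero) (+≤+ ())
1≤i+i⇒1≤i -[1+ k ] ()

i<+1+∣i∣ : ∀ i → i < + suc ∣ i ∣
i<+1+∣i∣ (+ k)    = +<+ ℕₚ.≤-refl
i<+1+∣i∣ -[1+ k ] = -<+

≡+⇔-≡ : ∀ {x y t : ℤ} → (y ≡ x + t) ⇔ (y - x ≡ t)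
≡+⇔-≡ {x} {y} {t} = mk⇔ (λ { refl → cancel x t }) (λ { refl → restore x y })
  where
  cancel : ∀ x t → x + t - x ≡ t
  cancel = solve-∀
  restore : ∀ x y → y ≡ x + (y - x)
  restore = solve-∀

i-j<k : ∀ {i j} k → i < + suc k → + 1 ≤ j → i - j < + k
i-j<k k i<1+k 1≤j = ℤₚ.+-mono-<-≤ i<1+k (ℤₚ.neg-mono-≤ 1≤j)

⟨_,_⟩ : ∀ {n} → ℤVec n → ℤVec n → ℤ
⟨ w , γ ⟩ = sum (λ k → w k * γ k)

⟨,⟩-⊖ : ∀ {n} (w γ δ : ℤVec n) → ⟨ w , γ ⊖ δ ⟩ ≡ ⟨ w , γ ⟩ - ⟨ w , δ ⟩
⟨,⟩-⊖ w γ δ = trans (sum-cong-≗ (λ k → distrib (w k) (γ k) (δ k)))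
                    (∑-distrib-− (λ k → w k * γ k) (λ k → w k * δ k))
  where
  distrib : ∀ a b c → a * (b - c) ≡ a * b - a * c
  distrib = solve-∀

⟨,⟩-zeroʳ : ∀ {n} (w γ : ℤVec n) → (∀ k → γ k ≡ 0ℤ) → ⟨ w , γ ⟩ ≡ 0ℤ
⟨,⟩-zeroʳ {n} w γ γ≡0 =
  trans (sum-cong-≗ (λ k → trans (cong (w k *_) (γ≡0 k)) (ℤₚ.*-zeroʳ (w k))))
        (sum-replicate-zero n)

module NonnegativeCombinations {n r : ℕ} (gen : Fin r → ℤVec n) where

  data Cone (γ : ℤVec n) : Set where
    origin : (∀ k → γ k ≡ 0ℤ) → Cone γ
    shift  : (m : Fin r) → Cone (γ ⊖ gen m) → Cone γ

  module Decision (w : ℤVec n) (gen-positive : ∀ m → + 1 ≤ ⟨ w , gen m ⟩) where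

    Cone⇒0≤⟨w,γ⟩ : ∀ {γ} → Cone γ → 0ℤ ≤ ⟨ w , γ ⟩
    Cone⇒0≤⟨w,γ⟩ {γ} (origin γ≡0) = ℤₚ.≤-reflexive (sym (⟨,⟩-zeroʳ w γ γ≡0))
    Cone⇒0≤⟨w,γ⟩ {γ} (shift m c) = ℤₚ.≤-trans (ℤₚ.≤-trans (+≤+ z≤n) (gen-positive m))
      (ℤₚ.0≤i-j⇒j≤i (subst (0ℤ ≤_) (⟨,⟩-⊖ w γ (gen m)) (Cone⇒0≤⟨w,γ⟩ c)))

    cone-within? : ∀ N γ → ⟨ w , γ ⟩ < + N → Dec (Cone γ)
    cone-within? zero    γ bound = no λ c → ℤₚ.≤⇒≯ (Cone⇒0≤⟨w,γ⟩ c) bound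
    cone-within? (suc N) γ bound with all? (λ k → γ k ℤₚ.≟ 0ℤ)
    ... | yes γ≡0 = yes (origin γ≡0)
    ... | no  γ≢0 = Dec.map′ (λ (m , c) → shift m c) reduce
                      (any? λ m → cone-within? N (γ ⊖ gen m) (smaller m))
      where
      smaller : ∀ m → ⟨ w , γ ⊖ gen m ⟩ < + N
      smaller m = subst (_< + N) (sym (⟨,⟩-⊖ w γ (gen m))) (i-j<k N bound (gen-positive m))
      reduce : Cone γ → ∃ λ m → Cone (γ ⊖ gen m)
      reduce (origin γ≡0) = contradiction γ≡0 γ≢0
      reduce (shift m c)  = m , c

    cone? : ∀ γ → Dec (Cone γ)
    cone? γ = cone-within? (suc ∣ ⟨ w , γ ⟩ ∣) γ (i<+1+∣i∣ ⟨ w , γ ⟩)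

crossing-edge : ∀ {a ℓ p} {A : Set a} {R : Rel A ℓ} {P : Pred A p} → Decidable P →
  ∀ {x z} → Star R x z → P x → ¬ P z → ∃₂ λ u v → R u v × P u × ¬ P v
crossing-edge P? ε              Px ¬Pz = contradiction Px ¬Pz
crossing-edge P? (_◅_ {j = v} xRv v⋆z) Px ¬Pz with P? v
... | yes Pv  = crossing-edge P? v⋆z Pv ¬Pz
... | no  ¬Pv = _ , v , xRv , Px , ¬Pv

constant-or-descent : ∀ {k} (l : Fin (suc k) → ℕ) → WeaklyDecreasing l →
  (∀ i → l i ≡ l zero) ⊎ ∃ λ m → l (suc m) ℕ.< l (inject₁ m)
constant-or-descent {zero}  l l↓ = inj₁ λ { zero → refl }
constant-or-descent {suc k} l l↓ with l (suc zero) ℕ.<? l zero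
... | yes drop = inj₂ (zero , drop)
... | no ¬drop
    with constant-or-descent (λ i → l (suc i)) (λ i j i≤j → l↓ (suc i) (suc j) (s≤s i≤j))
...   | inj₂ (m , drop) = inj₂ (suc m , drop)
...   | inj₁ tail-constant = inj₁ λ
  { zero    → refl
  ; (suc i) → trans (tail-constant i) (ℕₚ.≤-antisym (l↓ zero (suc zero) z≤n) (ℕₚ.≮⇒≥ ¬drop)) }

-- Matching on the Dec itself (rather than taking 'does') lets 'with i ≤ᶠ? m' reduce prefix m i.
indicator : ∀ {p} {P : Set p} → Dec P → ℕ
indicator (yes _) = 1
indicator (no  _) = 0

prefix : ∀ {r n} → Fin r → Fin n → ℕ
prefix m i = indicator (i ≤ᶠ? m)

prefix-decreasing : ∀ {r n} (m : Fin r) → WeaklyDecreasing {n} (prefix m)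
prefix-decreasing m i j i≤j with i ≤ᶠ? m | j ≤ᶠ? m
... | yes _   | yes _  = ℕₚ.≤-refl
... | yes _   | no  _  = z≤n
... | no  _   | no  _  = ℕₚ.≤-refl
... | no  i≰m | yes j≤m = contradiction (ℕₚ.≤-trans i≤j j≤m) i≰m

module Descent {k} (l : Fin (suc k) → ℕ) (l↓ : WeaklyDecreasing l)
               (m : Fin k) (drop : l (suc m) ℕ.< l (inject₁ m)) where

  lowered : Fin (suc k) → ℕ
  lowered i = l i ∸ prefix m i

  private
    inPrefix⇒l-drop : ∀ {i} → i ≤ᶠ m → l (suc m) ℕ.< l i
    inPrefix⇒l-drop {i} i≤m =
      ℕₚ.<-≤-trans drop (l↓ i (inject₁ m) (subst (toℕ i ℕ.≤_) (sym (toℕ-inject₁ m)) i≤m))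

  l≡lowered+prefix : ∀ i → l i ≡ lowered i ℕ.+ prefix m i
  l≡lowered+prefix i with i ≤ᶠ? m
  ... | yes i≤m = sym (ℕₚ.m∸n+n≡m (ℕₚ.≤-trans (s≤s z≤n) (inPrefix⇒l-drop i≤m)))
  ... | no  _   = sym (ℕₚ.+-identityʳ (l i))

  lowered-decreasing : WeaklyDecreasing lowered
  lowered-decreasing i j i≤j with i ≤ᶠ? m | j ≤ᶠ? m
  ... | yes _   | yes _   = ℕₚ.∸-monoˡ-≤ 1 (l↓ i j i≤j)
  ... | no  _   | no  _   = l↓ i j i≤j
  ... | no  i≰m | yes j≤m = contradiction (ℕₚ.≤-trans i≤j j≤m) i≰m
  ... | yes i≤m | no  j≰m =
    ℕₚ.≤-trans (l↓ (suc m) j (ℕₚ.≰⇒> j≰m)) (ℕₚ.∸-monoˡ-≤ 1 (inPrefix⇒l-drop i≤m))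

module Toppling {n} (G : Graph n) where

  A : Fin n → Fin n → ℤ
  A k i = ind (adj G k i)

  lift : (Fin n → ℕ) → ℤVec n
  lift l i = + l i

  topple : ℤVec n → ℤVec n
  topple a k = sum (λ i → a i * Δ G i k)

  T^≡+topple : ∀ a α k → T^ G a α k ≡ α k + topple a k
  T^≡+topple a α k = cong (_+_ (α k)) (sumFin≡sum (λ i → a i * Δ G i k))

  topple-as-differences : ∀ a k → topple a k ≡ sum (λ i → A k i * (a i - a k))
  topple-as-differences a k = begin
    sum (λ i → a i * Δ G i k)
      ≡⟨ sum-cong-≗ (λ i → expand (a i) (A k i) (ind (does (k ≟ i))) (degree G i)) ⟩
    sum (λ i → a i * A k i - ind (does (k ≟ i)) * (a i * degree G i))
      ≡⟨ ∑-distrib-− (λ i → a i * A k i) (λ i → ind (does (k ≟ i)) * (a i * degree G i)) ⟩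
    sum (λ i → a i * A k i) - sum (λ i → ind (does (k ≟ i)) * (a i * degree G i))
      ≡⟨ cong (_-_ (sum (λ i → a i * A k i))) (∑-select k (λ i → a i * degree G i)) ⟩
    sum (λ i → a i * A k i) - a k * degree G k
      ≡⟨ cong (λ d → sum (λ i → a i * A k i) - a k * d) (sumFin≡sum (A k)) ⟩
    sum (λ i → a i * A k i) - a k * sum (A k)
      ≡⟨ cong (_-_ (sum (λ i → a i * A k i))) (*-distribˡ-sum (a k) (A k)) ⟩
    sum (λ i → a i * A k i) - sum (λ i → a k * A k i)
      ≡⟨ sym (∑-distrib-− (λ i → a i * A k i) (λ i → a k * A k i)) ⟩
    sum (λ i → a i * A k i - a k * A k i)
      ≡⟨ sum-cong-≗ (λ i → factor (a i) (a k) (A k i)) ⟩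
    sum (λ i → A k i * (a i - a k)) ∎
    where
    open ≡-Reasoning
    expand : ∀ x e δ d → x * (e - δ * d) ≡ x * e - δ * (x * d)
    expand = solve-∀
    factor : ∀ x y e → x * e - y * e ≡ e * (x - y)
    factor = solve-∀

  topple-const : ∀ c k → topple (λ _ → c) k ≡ 0ℤ
  topple-const c k = begin
    topple (λ _ → c) k                ≡⟨ topple-as-differences (λ _ → c) k ⟩
    sum (λ i → A k i * (c - c))       ≡⟨ sum-cong-≗ (λ i → cong (A k i *_) (ℤₚ.+-inverseʳ c)) ⟩
    sum (λ i → A k i * 0ℤ)            ≡⟨ sum-cong-≗ (λ i → ℤₚ.*-zeroʳ (A k i)) ⟩
    sum {n} (λ _ → 0ℤ)                ≡⟨ sum-replicate-zero n ⟩
    0ℤ                                ∎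
    where open ≡-Reasoning

  topple-cong : ∀ {a b} → (∀ i → a i ≡ b i) → ∀ k → topple a k ≡ topple b k
  topple-cong a≗b k = sum-cong-≗ (λ i → cong (_* Δ G i k) (a≗b i))

  topple-+ : ∀ a b k → topple (λ i → a i + b i) k ≡ topple a k + topple b k
  topple-+ a b k = trans (sum-cong-≗ (λ i → ℤₚ.*-distribʳ-+ (Δ G i k) (a i) (b i)))
                         (∑-distrib-+ (λ i → a i * Δ G i k) (λ i → b i * Δ G i k))

  ⟨,⟩-topple-doubled : ∀ w a → ⟨ w , topple a ⟩ + ⟨ w , topple a ⟩ ≡
    sum (λ k → sum (λ i → A k i * ((w k - w i) * (a i - a k))))
  ⟨,⟩-topple-doubled w a = begin
    ⟨ w , topple a ⟩ + ⟨ w , topple a ⟩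
      ≡⟨ cong (λ s → s + s) pairing≡S ⟩
    S + S
      ≡⟨ cong (_+_ S) (∑-comm F) ⟩
    S + sum (λ k → sum (λ i → F i k))
      ≡⟨ sym (∑-distrib-+ (λ k → sum (F k)) (λ k → sum (λ i → F i k))) ⟩
    sum (λ k → sum (F k) + sum (λ i → F i k))
      ≡⟨ sum-cong-≗ (λ k → sym (∑-distrib-+ (F k) (λ i → F i k))) ⟩
    sum (λ k → sum (λ i → F k i + F i k))
      ≡⟨ sum-cong-≗ (λ k → sum-cong-≗ (λ i → pair-up k i)) ⟩
    sum (λ k → sum (λ i → A k i * ((w k - w i) * (a i - a k)))) ∎
    where
    open ≡-Reasoning
    F : Fin n → Fin n → ℤ
    F k i = w k * (A k i * (a i - a k))
    S : ℤ
    S = sum (λ k → sum (F k))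
    pairing≡S : ⟨ w , topple a ⟩ ≡ S
    pairing≡S = sum-cong-≗ λ k → trans (cong (w k *_) (topple-as-differences a k))
                                        (*-distribˡ-sum (w k) (λ i → A k i * (a i - a k)))
    combine : ∀ wk wi e ai ak →
      wk * (e * (ai - ak)) + wi * (e * (ak - ai)) ≡ e * ((wk - wi) * (ai - ak))
    combine = solve-∀
    pair-up : ∀ k i → F k i + F i k ≡ A k i * ((w k - w i) * (a i - a k))
    pair-up k i rewrite adj-sym G i k = combine (w k) (w i) (A k i) (a i) (a k)

  Reachable : ℤVec n → Set
  Reachable γ = Σ (Fin n → ℕ) λ l → WeaklyDecreasing l × (∀ k → γ k ≡ topple (lift l) k)

  dominated⇔reachable : ∀ α β → Dominated G β α ⇔ Reachable (β ⊖ α)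
  dominated⇔reachable α β = mk⇔
    (λ (l , l↓ , eq) → l , l↓ , λ k →
      Equivalence.to ≡+⇔-≡ (trans (eq k) (T^≡+topple (lift l) α k)))
    (λ (l , l↓ , eq) → l , l↓ , λ k →
      trans (Equivalence.from ≡+⇔-≡ (eq k)) (sym (T^≡+topple (lift l) α k)))

module PrefixGenerators {n′} (G : Graph (suc n′)) where
  open Toppling G

  generator : Fin n′ → ℤVec (suc n′)
  generator m = topple (lift (prefix m))

  open NonnegativeCombinations generator

  cone⇒reachable : ∀ {γ} → Cone γ → Reachable γ
  cone⇒reachable (origin γ≡0) =
    (λ _ → 0) , (λ _ _ _ → z≤n) , λ k → trans (γ≡0 k) (sym (topple-const 0ℤ k))
  cone⇒reachable {γ} (shift m c) with cone⇒reachable c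
  ... | l , l↓ , eq = (λ i → l i ℕ.+ prefix m i)
                    , (λ i j i≤j → ℕₚ.+-mono-≤ (l↓ i j i≤j) (prefix-decreasing m i j i≤j))
                    , λ k → begin
      γ k                                         ≡⟨ Equivalence.from ≡+⇔-≡ (eq k) ⟩
      generator m k + topple (lift l) k           ≡⟨ ℤₚ.+-comm (generator m k) _ ⟩
      topple (lift l) k + generator m k           ≡⟨ sym (topple-+ (lift l) (lift (prefix m)) k) ⟩
      topple (lift (λ i → l i ℕ.+ prefix m i)) k  ∎
    where open ≡-Reasoning

  reachable-within⇒cone : ∀ N {γ} l → WeaklyDecreasing l → (∀ k → γ k ≡ topple (lift l) k) →
    l zero ℕ.< N → Cone γ
  reachable-within⇒cone N l l↓ eq l₀<N with constant-or-descent l l↓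
  ... | inj₁ constant = origin λ k → trans (eq k)
          (trans (topple-cong (λ i → cong +_ (constant i)) k) (topple-const (+ l zero) k))
  reachable-within⇒cone zero    l l↓ eq () | inj₂ _
  reachable-within⇒cone (suc N) {γ} l l↓ eq l₀<N | inj₂ (m , drop) =
    shift m (reachable-within⇒cone N lowered lowered-decreasing eq′ lowered₀<N)
    where
    open Descent l l↓ m drop
    eq′ : ∀ k → (γ ⊖ generator m) k ≡ topple (lift lowered) k
    eq′ k = Equivalence.to ≡+⇔-≡ (begin
      γ k
        ≡⟨ eq k ⟩
      topple (lift l) k
        ≡⟨ topple-cong (λ i → cong +_ (l≡lowered+prefix i)) k ⟩
      topple (λ i → lift lowered i + lift (prefix m) i) k
        ≡⟨ topple-+ (lift lowered) (lift (prefix m)) k ⟩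
      topple (lift lowered) k + generator m k
        ≡⟨ ℤₚ.+-comm _ (generator m k) ⟩
      generator m k + topple (lift lowered) k ∎)
      where open ≡-Reasoning
    lowered₀<N : lowered zero ℕ.< N
    lowered₀<N = subst (ℕ._≤ N) (trans (l≡lowered+prefix zero) (ℕₚ.+-comm (lowered zero) 1))
                       (ℕₚ.≤-pred l₀<N)

  reachable⇒cone : ∀ {γ} → Reachable γ → Cone γ
  reachable⇒cone (l , l↓ , eq) = reachable-within⇒cone (suc (l zero)) l l↓ eq ℕₚ.≤-refl

  rank : ℤVec (suc n′)
  rank i = + toℕ i

  rank-gap : ∀ {p q : Fin (suc n′)} → toℕ p ℕ.< toℕ q → + 1 ≤ rank q - rank p
  rank-gap {p} {q} p<q =
    ℤₚ.≤-trans (ℤₚ.≤-reflexive (sym (cancel (rank p)))) (ℤₚ.+-monoˡ-≤ (- rank p) (+≤+ p<q))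
    where
    cancel : ∀ x → + 1 + x - x ≡ + 1
    cancel = solve-∀

  separation : Fin n′ → Fin (suc n′) → Fin (suc n′) → ℤ
  separation m k i = (rank k - rank i) * (+ prefix m i - + prefix m k)

  private
    flip : ∀ x y → (x - y) * - + 1 ≡ y - x
    flip = solve-∀

    entering : ∀ {m : Fin n′} {k i} → i ≤ᶠ m → ¬ k ≤ᶠ m → + 1 ≤ (rank k - rank i) * + 1
    entering {k = k} {i} i≤m k≰m = subst (+ 1 ≤_) (sym (ℤₚ.*-identityʳ (rank k - rank i)))
      (rank-gap (ℕₚ.≤-<-trans i≤m (ℕₚ.≰⇒> k≰m)))

    leaving : ∀ {m : Fin n′} {k i} → k ≤ᶠ m → ¬ i ≤ᶠ m → + 1 ≤ (rank k - rank i) * - + 1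
    leaving {k = k} {i} k≤m i≰m = subst (+ 1 ≤_) (sym (flip (rank k) (rank i)))
      (rank-gap (ℕₚ.≤-<-trans k≤m (ℕₚ.≰⇒> i≰m)))

  separation-nonneg : ∀ m k i → 0ℤ ≤ separation m k i
  separation-nonneg m k i with i ≤ᶠ? m | k ≤ᶠ? m
  ... | yes _   | yes _   = ℤₚ.≤-reflexive (sym (ℤₚ.*-zeroʳ (rank k - rank i)))
  ... | no  _   | no  _   = ℤₚ.≤-reflexive (sym (ℤₚ.*-zeroʳ (rank k - rank i)))
  ... | yes i≤m | no  k≰m = ℤₚ.≤-trans (+≤+ z≤n) (entering i≤m k≰m)
  ... | no  i≰m | yes k≤m = ℤₚ.≤-trans (+≤+ z≤n) (leaving k≤m i≰m)

  separation-across : ∀ m {k i} → k ≤ᶠ m → ¬ i ≤ᶠ m → + 1 ≤ separation m k i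
  separation-across m {k} {i} k≤m i≰m with i ≤ᶠ? m | k ≤ᶠ? m
  ... | yes i≤m | _       = contradiction i≤m i≰m
  ... | no  _   | no  k≰m = contradiction k≤m k≰m
  ... | no  _   | yes _   = leaving k≤m i≰m

  edge-term-nonneg : ∀ m k i → 0ℤ ≤ A k i * separation m k i
  edge-term-nonneg m k i with adj G k i
  ... | true  = subst (0ℤ ≤_) (sym (ℤₚ.*-identityˡ _)) (separation-nonneg m k i)
  ... | false = ℤₚ.≤-refl

  generator-positive : Connected G → ∀ m → + 1 ≤ ⟨ rank , generator m ⟩
  generator-positive conn m with crossing-edge (_≤ᶠ? m) (conn zero (fromℕ n′)) z≤n last∉prefix
    where
    last∉prefix : ¬ fromℕ n′ ≤ᶠ m
    last∉prefix last≤m = ℕₚ.<⇒≱ (toℕ<n m) (subst (ℕ._≤ toℕ m) (toℕ-fromℕ n′) last≤m)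
  ... | k , i , k~i , k≤m , i≰m = 1≤i+i⇒1≤i ⟨ rank , generator m ⟩
    (subst (+ 1 ≤_) (sym (⟨,⟩-topple-doubled rank (lift (prefix m))))
      (ℤₚ.≤-trans crossing-term
        (ℤₚ.≤-trans (term≤∑ (edge-terms k) (edge-term-nonneg m k) i)
                    (term≤∑ (λ k → sum (edge-terms k))
                            (λ k → ∑-nonneg (edge-terms k) (edge-term-nonneg m k)) k))))
    where
    edge-terms : Fin (suc n′) → Fin (suc n′) → ℤ
    edge-terms k i = A k i * separation m k i
    crossing-term : + 1 ≤ A k i * separation m k i
    crossing-term rewrite k~i =
      subst (+ 1 ≤_) (sym (ℤₚ.*-identityˡ _)) (separation-across m k≤m i≰m)

reachable? : ∀ {n} (G : Graph n) → Connected G → ∀ γ → Dec (Toppling.Reachable G γ)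
reachable? {zero}   G conn γ = yes ((λ ()) , (λ ()) , (λ ()))
reachable? {suc n′} G conn γ = Dec.map′ cone⇒reachable reachable⇒cone (cone? γ)
  where
  open PrefixGenerators G
  open NonnegativeCombinations generator
  open Decision rank (generator-positive conn)

mainTheorem8 : ∀ (n : ℕ) (G : Graph n) → Connected G →
    Σ (ℤVec n → ℤ) λ c → ∀ (α β : ℤVec n) → HCoeff G α β (c (β ⊖ α))
mainTheorem8 n G conn = (λ γ → ind (does (reachable? G conn γ))) , coefficient
  where
  open Toppling G
  coefficient : ∀ α β → HCoeff G α β (ind (does (reachable? G conn (β ⊖ α))))
  coefficient α β with reachable? G conn (β ⊖ α)
  ... | yes r  = inj₁ (Equivalence.from (dominated⇔reachable α β) r , refl)
  ... | no  ¬r = inj₂ ((λ d → ¬r (Equivalence.to (dominated⇔reachable α β) d)) , refl)
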